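{- Let $d\geq 1$ be an integer. For every graph $G$ and every $d$-clique lift $\mathcal{M}$ of $G$, the graph $G^{\mathcal{M}}$ is a $1$-shallow minor of $G\circ\overline{K_{d+1}}$.
   Context: All graphs are finite and simple. A $d$-clique lift of $G$ is a family $\mathcal{M}=\{M_v:v\in V(G)\}$ with $M_v\subseteq N_G(v)$ and $|M_v|\leq d$ for each $v$. $G^{\mathcal{M}}$ is the graph obtained from $G$ by adding the edge $uw$ (for distinct $u,w$) whenever there is $v\in V(G)$ with $u\in M_v$ and $w\in N_G(v)$. $\overline{K_{d+1}}$ is the edgeless graph on $d+1$ vertices; the lexicographic product $A\circ B$ has vertex set $V(A)\times V(B)$, with $(a,v)(b,u)$ an edge iff $ab\in E(A)$, or $a=b$ and $uv\in E(B)$. $H$ is a $1$-shallow minor of $X$ if there is a map $\mu$ assigning to each $v\in V(H)$ a connected subgraph $\mu(v)$ of $X$ of radius at most $1$, pairwise vertex-disjoint, such that for every edge $vw\in E(H)$ some edge of $X$ joins $\mu(v)$ and $\mu(w)$. -}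

module Defs where

open import Data.Nat using (ℕ; suc; _≤_)
open import Data.Fin using (Fin)
open import Data.Fin.Subset using (Subset; _∈_; ∣_∣)
open import Data.Bool using (Bool; true; false)
open import Data.Product using (Σ; ∃; ∃-syntax; _×_; _,_)
open import Data.Sum using (_⊎_)
open import Relation.Binary.PropositionalEquality using (_≡_; _≢_)

record Graph : Set where
  field
    n      : ℕ
    adj    : Fin n → Fin n → Bool
    adj-sym   : ∀ u v → adj u v ≡ adj v u
    adj-irrefl : ∀ v → adj v v ≡ false
open Graph public


Adj : (G : Graph) → Fin (n G) → Fin (n G) → Set
Adj G u v = adj G u v ≡ true

record CliqueLift (d : ℕ) (G : Graph) : Set where
  field
    M        : Fin (n G) → Subset (n G)
    M-nbr    : ∀ v u → u ∈ M v → Adj G v u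
    M-size   : ∀ v → ∣ M v ∣ ≤ d
open CliqueLift public

Added : {d : ℕ} (G : Graph) → CliqueLift d G → Fin (n G) → Fin (n G) → Set
Added G 𝓜 u w = ∃[ v ] (u ∈ M 𝓜 v × Adj G v w)

-- Adjacency in G^𝓜 (edges are unordered, so the added-edge condition is symmetrised).
AdjLift : {d : ℕ} (G : Graph) → CliqueLift d G → Fin (n G) → Fin (n G) → Set
AdjLift G 𝓜 u w =
  u ≢ w × (Adj G u w ⊎ (Added G 𝓜 u w ⊎ Added G 𝓜 w u))

-- Adjacency in the lexicographic product G ∘ \overline{K_{k}} (second factor edgeless):
-- (a,i)(b,j) is an edge iff ab ∈ E(G).
AdjLex : (G : Graph) (k : ℕ) → Fin (n G) × Fin k → Fin (n G) × Fin k → Set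
AdjLex G k (a , _) (b , _) = Adj G a b

-- Branch sets are given by a membership relation B together with a centre for each
-- v ∈ VH: the centre lies in B v and every other vertex of B v is X-adjacent to the
-- centre (so the subgraph of X consisting of B v with these star edges is connected
-- of radius ≤ 1).
record ShallowMinor1 (VH : Set) (EH : VH → VH → Set)
                     (VX : Set) (EX : VX → VX → Set) : Set₁ where
  field
    B        : VH → VX → Set
    centre   : VH → VX
    centre∈  : ∀ v → B v (centre v)
    radius1  : ∀ v x → B v x → x ≡ centre v ⊎ EX (centre v) x
    disjoint : ∀ v w x → B v x → B w x → v ≡ w
    edges    : ∀ v w → EH v w → ∃[ x ] ∃[ y ] (B v x × B w y × EX x y)

IsShallowMinor1 : (VH : Set) (EH : VH → VH → Set) (VX : Set) (EX : VX → VX → Set) → Set₁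
IsShallowMinor1 VH EH VX EX = ShallowMinor1 VH EH VX EX

{-# OPTIONS --safe #-}
module Submission where

-- The branch set of u is the star centred at the copy (u, 0),
-- together with one copy (v, i) of every vertex v with u ∈ M_v; these copies
-- are adjacent to (u, 0) because M_v ⊆ N_G(v).  Since |M_v| ≤ d, the members
-- of M_v can be given pairwise different slots i ∈ {1, …, d} above v, which
-- keeps the branch sets disjoint.  An added edge uw, witnessed by u ∈ M_v and
-- w ∈ N_G(v), is then realised by the edge between (v, i) and (w, 0).

open import Defs
open import Data.Nat using (ℕ; suc; _≤_)
open import Data.Fin using (Fin; zero; suc; inject≤)
open import Data.Fin.Properties using (suc-injective; inject≤-injective)
open import Data.Fin.Subset using (Subset; _∈_; ∣_∣)
open import Data.Vec.Base using (_∷_; here; there)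
open import Data.Bool using (true; false)
open import Data.Product using (_×_; _,_; ∃-syntax)
open import Data.Sum using (_⊎_; inj₁; inj₂)
open import Relation.Binary.PropositionalEquality using (_≡_; refl; sym; trans; cong)

position : ∀ {m} {p : Subset m} {u : Fin m} → u ∈ p → Fin ∣ p ∣
position {p = true ∷ _}  here      = zero
position {p = true ∷ _}  (there i) = suc (position i)
position {p = false ∷ _} (there i) = position i

position-injective : ∀ {m} {p : Subset m} {u w : Fin m} (i : u ∈ p) (j : w ∈ p) →
                     position i ≡ position j → u ≡ w
position-injective {p = true ∷ _}  here      here      _ = refl
position-injective {p = true ∷ _}  (there i) (there j) e =
  cong suc (position-injective i j (suc-injective e))
position-injective {p = false ∷ _} (there i) (there j) e =
  cong suc (position-injective i j e)

Adj-sym : (G : Graph) {u w : Fin (n G)} → Adj G u w → Adj G w u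
Adj-sym G {u} {w} a = trans (adj-sym G w u) a

module LiftMinor {d : ℕ} (G : Graph) (𝓜 : CliqueLift d G) where

  V : Set
  V = Fin (n G)

  Copy : Set
  Copy = V × Fin (suc d)

  _~_ : Copy → Copy → Set
  _~_ = AdjLex G (suc d)

  slot : {u v : V} → u ∈ M 𝓜 v → Fin (suc d)
  slot {v = v} m = suc (inject≤ (position m) (M-size 𝓜 v))

  slot-injective : {u w v : V} (i : u ∈ M 𝓜 v) (j : w ∈ M 𝓜 v) → slot i ≡ slot j → u ≡ w
  slot-injective {v = v} i j e =
    position-injective i j (inject≤-injective (M-size 𝓜 v) (M-size 𝓜 v) _ _ (suc-injective e))

  data Branch (u : V) : Copy → Set where
    centre    : Branch u (u , zero)
    satellite : ∀ {v i} (m : u ∈ M 𝓜 v) → i ≡ slot m → Branch u (v , i)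

  branch-star : ∀ u x → Branch u x → x ≡ (u , zero) ⊎ (u , zero) ~ x
  branch-star u _ centre                     = inj₁ refl
  branch-star u _ (satellite {v = v} m refl) = inj₂ (Adj-sym G (M-nbr 𝓜 v u m))

  branch-disjoint : ∀ u w x → Branch u x → Branch w x → u ≡ w
  branch-disjoint u .u _ centre           centre           = refl
  branch-disjoint u w  _ centre           (satellite _ ())
  branch-disjoint u w  _ (satellite _ ()) centre
  branch-disjoint u w  _ (satellite i e)  (satellite j e′) = slot-injective i j (trans (sym e) e′)

  Realised : V → V → Set
  Realised u w = ∃[ x ] ∃[ y ] (Branch u x × Branch w y × x ~ y)

  realised-sym : ∀ {u w} → Realised u w → Realised w u
  realised-sym (x , y , bx , by , e) = y , x , by , bx , Adj-sym G e

  added-realised : ∀ {u w} → Added G 𝓜 u w → Realised u w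
  added-realised (v , m , a) = _ , _ , satellite m refl , centre , a

  lift-edge-realised : ∀ u w → AdjLift G 𝓜 u w → Realised u w
  lift-edge-realised u w (_ , inj₁ a)         = _ , _ , centre , centre , a
  lift-edge-realised u w (_ , inj₂ (inj₁ ad)) = added-realised ad
  lift-edge-realised u w (_ , inj₂ (inj₂ ad)) = realised-sym (added-realised ad)

  isShallowMinor1 : IsShallowMinor1 V (AdjLift G 𝓜) Copy _~_
  isShallowMinor1 = record
    { B        = Branch
    ; centre   = λ u → (u , zero)
    ; centre∈  = λ u → centre
    ; radius1  = branch-star
    ; disjoint = branch-disjoint
    ; edges    = lift-edge-realised
    }

lemma23 : (d : ℕ) → 1 ≤ d → (G : Graph) → (𝓜 : CliqueLift d G) →
    IsShallowMinor1 (Fin (n G)) (AdjLift G 𝓜) (Fin (n G) × Fin (suc d)) (AdjLex G (suc d))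
lemma23 d _ G 𝓜 = LiftMinor.isShallowMinor1 G 𝓜
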